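{- Let $M := \{0,1\}$ be the monoid whose product is the multiplication of integers, and let $\mathsf{D}$ be the sub-operad of $\mathsf{T}M$ generated by the words $01$ and $10$. Then the elements of $\mathsf{D}$ are exactly the nonempty words over $\{0,1\}$ containing exactly one occurrence of $1$. Moreover, $\mathsf{D}$ is isomorphic (as a nonsymmetric operad) to the diassociative operad.
   Context: $\mathsf{T}M := \biguplus_{n\ge1}M^n$ is the set of nonempty words over $M=\{0,1\}$, a word of length $n$ having arity $n$, with partial compositions $x\circ_i y := (x_1,\dots,x_{i-1}, x_i y_1,\dots,x_i y_m, x_{i+1},\dots,x_n)$ (products of integers) for $x$ of length $n$, $y$ of length $m$, $1\le i\le n$; its unit is the word $1$ of length $1$. The sub-operad generated by a set $G$ of words is the smallest subset containing $G$ and the unit and closed under all partial compositions $\circ_i$. The diassociative operad is the nonsymmetric set-operad generated by two generators $\dashv$ and $\vdash$ of arity two subject to the relations $\dashv\circ_1\dashv \,=\, \dashv\circ_2\dashv \,=\, \dashv\circ_2\vdash$, $\dashv\circ_1\vdash \,=\, \vdash\circ_2\dashv$, $\vdash\circ_1\dashv \,=\, \vdash\circ_2\vdash \,=\, \vdash\circ_1\vdash$ (equivalently, $(x\dashv y)\dashv z = x\dashv(y\dashv z) = x\dashv(y\vdash z)$, $(x\vdash y)\dashv z = x\vdash(y\dashv z)$, $(x\dashv y)\vdash z = x\vdash(y\vdash z) = (x\vdash y)\vdash z$). -}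

module Defs where

open import Data.Nat using (ℕ; zero; suc; _+_)
open import Data.Bool using (Bool; true; false; _∧_)
open import Data.List using (List; []; _∷_; _++_; map; length)
open import Data.Fin using (Fin; zero; suc; splitAt; cast)
open import Data.Sum using (inj₁; inj₂)
import Data.Product
import Data.Fin
open import Relation.Binary.PropositionalEquality using (_≡_; sym)

-- The operad T M for M = {0,1} (false = 0, true = 1, product = _∧_).
-- A word is a list of letters; its arity is its length
-- (elements of T M are the nonempty words).

Word : Set
Word = List Bool

-- partial composition x ∘ᵢ y, with i a 0-based position in x
-- (i.e. Fin.zero stands for ∘₁).
_∘[_]_ : (x : Word) → Fin (length x) → Word → Word
(a ∷ xs) ∘[ zero ] y = map (a ∧_) y ++ xs
(a ∷ xs) ∘[ suc i ] y = a ∷ (xs ∘[ i ] y)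

unitW : Word
unitW = true ∷ []

data InD : Word → Set where
  gen01 : InD (false ∷ true ∷ [])
  gen10 : InD (true ∷ false ∷ [])
  unit  : InD unitW
  comp  : ∀ {x y} → InD x → InD y → (i : Fin (length x)) → InD (x ∘[ i ] y)

ones : Word → ℕ
ones [] = 0
ones (true ∷ w) = suc (ones w)
ones (false ∷ w) = ones w

-- The diassociative operad, as the free nonsymmetric set-operad on two
-- binary generators ⊣ , ⊢ modulo the operad congruence generated by
-- the diassociative relations (quotient presented as a setoid).

data Gen : Set where
  ⊣ ⊢ : Gen

data Tree : Set where
  leaf : Tree
  node : Gen → Tree → Tree → Tree

leaves : Tree → ℕ
leaves leaf = 1
leaves (node _ l r) = leaves l + leaves r

-- partial composition (grafting t on the i-th leaf of s, 0-based)
graft : (s : Tree) → Fin (leaves s) → Tree → Tree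
graft leaf zero t = t
graft (node g l r) i t with splitAt (leaves l) i
... | inj₁ j = node g (graft l j t) r
... | inj₂ j = node g l (graft r j t)

gen : Gen → Tree
gen g = node g leaf leaf

_∘₁_ : Gen → Gen → Tree
g ∘₁ h = node g (gen h) leaf

_∘₂_ : Gen → Gen → Tree
g ∘₂ h = node g leaf (gen h)

data _≈D_ : Tree → Tree → Set where
  r1  : (⊣ ∘₁ ⊣) ≈D (⊣ ∘₂ ⊣)
  r2  : (⊣ ∘₂ ⊣) ≈D (⊣ ∘₂ ⊢)
  r3  : (⊣ ∘₁ ⊢) ≈D (⊢ ∘₂ ⊣)
  r4  : (⊢ ∘₁ ⊣) ≈D (⊢ ∘₂ ⊢)
  r5  : (⊢ ∘₂ ⊢) ≈D (⊢ ∘₁ ⊢)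
  ≈refl  : ∀ {s} → s ≈D s
  ≈sym   : ∀ {s t} → s ≈D t → t ≈D s
  ≈trans : ∀ {s t u} → s ≈D t → t ≈D u → s ≈D u
  ≈comp  : ∀ {s s' t t'} (p : s ≈D s') → t ≈D t' →
           (i : Fin (leaves s)) (i' : Fin (leaves s')) →
           Data.Fin.toℕ i ≡ Data.Fin.toℕ i' →
           graft s i t ≈D graft s' i' t'

-- An isomorphism of nonsymmetric operads between Dias (= Tree / ≈D)
-- and D (= words satisfying InD, with the compositions of T M).

record DiasIsoD : Set where
  field
    φ        : Tree → Word
    arity    : ∀ t → length (φ t) ≡ leaves t
    into     : ∀ t → InD (φ t)
    φ-unit   : φ leaf ≡ unitW
    φ-comp   : ∀ s (i : Fin (leaves s)) t →
               φ (graft s i t) ≡ (φ s ∘[ cast (sym (arity s)) i ] φ t)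
    respects : ∀ {s t} → s ≈D t → φ s ≡ φ t
    reflects : ∀ {s t} → φ s ≡ φ t → s ≈D t
    onto     : ∀ {w} → InD w → Data.Product.Σ Tree (λ t → φ t ≡ w)

module Submission where

-- Composing with a word that
-- has exactly one 1 does not change the number of 1s, so every element
-- of D has one 1.  Conversely a word with one 1 is 0ᵃ 1 0ᵇ, which is
-- obtained from the unit by a-fold composition with 01 and b-fold
-- composition with 10.
--
-- A tree is sent to the word φ t that records,
-- leaf by leaf, whether the leaf is the one selected by following ⊣ to
-- the left and ⊢ to the right: φ (l ⊣ r) = φ l 0…0 and φ (l ⊢ r) = 0…0 φ r.
-- The map is a morphism because masking a word (keeping it or erasing
-- its 1) commutes with composition, and it respects ≈D because every
-- relation is sent to an equality.  Using the relations in context, every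
-- tree is equivalent to a normal form  nf a b = ⊢-comb of depth a over a
-- ⊣-comb of depth b, whose image is 0ᵃ 1 0ᵇ; this gives that φ reflects
-- ≈D (images of normal forms determine a and b) and is onto D.

open import Defs
open import Data.Product using (_×_)
open import Function.Bundles using (_⇔_)
open import Relation.Binary.PropositionalEquality using (_≡_)

open import Data.Nat using (ℕ; zero; suc; _+_; _<_; s<s)
open import Data.Nat.Properties using (suc-injective)
open import Data.Bool using (true; false; _∧_)
open import Data.List using ([]; _∷_; _++_; map; length; replicate)
open import Data.List.Properties
  using (length-++; length-map; length-replicate; ++-identityʳ; ++-assoc; map-id; map-++; map-∘; ∷-injectiveʳ)
open import Data.Fin using (Fin; zero; suc; splitAt; cast; toℕ)
open import Data.Fin.Properties using (toℕ-↑ˡ; toℕ-↑ʳ; toℕ<n; toℕ-cast; splitAt⁻¹-↑ˡ; splitAt⁻¹-↑ʳ)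
open import Data.Sum using (inj₁; inj₂)
open import Data.Product using (Σ; _,_; ∃₂)
open import Function.Bundles using (mk⇔)
open import Level using (0ℓ)
open import Relation.Binary.Bundles using (Setoid)
import Relation.Binary.Reasoning.Setoid
open import Relation.Binary.PropositionalEquality
  using (refl; sym; trans; cong; cong₂; subst; module ≡-Reasoning)

zeros : ℕ → Word
zeros n = replicate n false

-- Composing into a letter 0 multiplies the inserted word by 0.
kill : Word → Word
kill = map (false ∧_)

oneAt : ℕ → ℕ → Word
oneAt a b = zeros a ++ true ∷ zeros b

kill-zeros : ∀ n → kill (zeros n) ≡ zeros n
kill-zeros zero    = refl
kill-zeros (suc n) = cong (false ∷_) (kill-zeros n)

ones-++ : ∀ u v → ones (u ++ v) ≡ ones u + ones v
ones-++ []          v = refl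
ones-++ (true ∷ u)  v = cong suc (ones-++ u v)
ones-++ (false ∷ u) v = ones-++ u v

ones-kill : ∀ w → ones (kill w) ≡ 0
ones-kill []      = refl
ones-kill (_ ∷ w) = ones-kill w

ones≡0⇒zeros : ∀ w → ones w ≡ 0 → w ≡ zeros (length w)
ones≡0⇒zeros []          _ = refl
ones≡0⇒zeros (false ∷ w) e = cong (false ∷_) (ones≡0⇒zeros w e)

ones≡1⇒oneAt : ∀ w → ones w ≡ 1 → ∃₂ λ a b → w ≡ oneAt a b
ones≡1⇒oneAt (true ∷ w)  e = 0 , length w , cong (true ∷_) (ones≡0⇒zeros w (suc-injective e))
ones≡1⇒oneAt (false ∷ w) e with ones≡1⇒oneAt w e
... | a , b , w≡ = suc a , b , cong (false ∷_) w≡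

-- The position of the 1 and the length determine a and b.
oneAt-injective : ∀ {a b c d} → oneAt a b ≡ oneAt c d → a ≡ c × b ≡ d
oneAt-injective {zero}  {b} {zero}  {d} e =
  refl , trans (sym (length-replicate b)) (trans (cong length (∷-injectiveʳ e)) (length-replicate d))
oneAt-injective {suc a} {b} {suc c} {d} e with oneAt-injective {a} {b} {c} {d} (∷-injectiveʳ e)
... | refl , b≡d = refl , b≡d

ones-∘ : ∀ x (i : Fin (length x)) y → ones y ≡ 1 → ones (x ∘[ i ] y) ≡ ones x
ones-∘ (true ∷ xs)  zero    y e = begin
  ones (map (true ∧_) y ++ xs)        ≡⟨ ones-++ (map (true ∧_) y) xs ⟩
  ones (map (true ∧_) y) + ones xs    ≡⟨ cong (λ w → ones w + ones xs) (map-id y) ⟩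
  ones y + ones xs                    ≡⟨ cong (_+ ones xs) e ⟩
  suc (ones xs)                       ∎
  where open ≡-Reasoning
ones-∘ (false ∷ xs) zero    y e = trans (ones-++ (kill y) xs) (cong (_+ ones xs) (ones-kill y))
ones-∘ (true ∷ xs)  (suc i) y e = cong suc (ones-∘ xs i y e)
ones-∘ (false ∷ xs) (suc i) y e = ones-∘ xs i y e

InD⇒ones : ∀ {w} → InD w → ones w ≡ 1
InD⇒ones gen01 = refl
InD⇒ones gen10 = refl
InD⇒ones unit  = refl
InD⇒ones (comp {x} {y} p q i) = trans (ones-∘ x i y (InD⇒ones q)) (InD⇒ones p)

-- 0ᵃ 1 0ᵇ = 01 ∘₂ (0ᵃ⁻¹ 1 0ᵇ)  and  1 0ᵇ = 10 ∘₂ (1 0ᵇ⁻¹).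
InD-oneAt : ∀ a b → InD (oneAt a b)
InD-oneAt zero    zero    = unit
InD-oneAt zero    (suc b) =
  subst InD (cong (λ w → true ∷ false ∷ w) (trans (++-identityʳ _) (kill-zeros b)))
    (comp gen10 (InD-oneAt zero b) (suc zero))
InD-oneAt (suc a) b =
  subst InD (cong (false ∷_) (trans (++-identityʳ _) (map-id (oneAt a b))))
    (comp gen01 (InD-oneAt a b) (suc zero))

ones⇒InD : ∀ w → ones w ≡ 1 → InD w
ones⇒InD w e with ones≡1⇒oneAt w e
... | a , b , refl = InD-oneAt a b

-- x ∘[ i ] y with the position given as a natural number, so that
-- positions in concatenations can be computed arithmetically.
_∘ₙ[_]_ : Word → ℕ → Word → Word
[]       ∘ₙ[ _     ] _ = []
(a ∷ xs) ∘ₙ[ zero  ] y = map (a ∧_) y ++ xs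
(a ∷ xs) ∘ₙ[ suc k ] y = a ∷ (xs ∘ₙ[ k ] y)

∘-as-∘ₙ : ∀ x (i : Fin (length x)) y → x ∘[ i ] y ≡ x ∘ₙ[ toℕ i ] y
∘-as-∘ₙ (a ∷ xs) zero    y = refl
∘-as-∘ₙ (a ∷ xs) (suc i) y = cong (a ∷_) (∘-as-∘ₙ xs i y)

∘ₙ-++ˡ : ∀ {n k} x z y → length x ≡ n → k < n → (x ++ z) ∘ₙ[ k ] y ≡ (x ∘ₙ[ k ] y) ++ z
∘ₙ-++ˡ {k = zero}  (a ∷ x) z y refl _       = sym (++-assoc (map (a ∧_) y) x z)
∘ₙ-++ˡ {k = suc k} (a ∷ x) z y refl (s<s p) = cong (a ∷_) (∘ₙ-++ˡ x z y refl p)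

∘ₙ-++ʳ : ∀ {n} x z k y → length x ≡ n → (x ++ z) ∘ₙ[ n + k ] y ≡ x ++ (z ∘ₙ[ k ] y)
∘ₙ-++ʳ []      z k y refl = refl
∘ₙ-++ʳ (a ∷ x) z k y refl = cong (a ∷_) (∘ₙ-++ʳ x z k y refl)

kill-∘ₙ : ∀ x k y → kill (x ∘ₙ[ k ] y) ≡ kill x ∘ₙ[ k ] y
kill-∘ₙ []       k       y = refl
kill-∘ₙ (a ∷ xs) zero    y = begin
  kill (map (a ∧_) y ++ xs)         ≡⟨ map-++ (false ∧_) (map (a ∧_) y) xs ⟩
  kill (map (a ∧_) y) ++ kill xs    ≡⟨ cong (_++ kill xs) (sym (map-∘ y)) ⟩
  kill y ++ kill xs                 ∎
  where open ≡-Reasoning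
kill-∘ₙ (a ∷ xs) (suc k) y = cong (false ∷_) (kill-∘ₙ xs k y)

-- x ⊣ y keeps the distinguished leaf of x and erases y; x ⊢ y the converse.
data Mask : Set where
  keep erase : Mask

masked : Mask → Word → Word
masked keep  w = w
masked erase w = kill w

leftMask rightMask : Gen → Mask
leftMask  ⊣ = keep
leftMask  ⊢ = erase
rightMask ⊣ = erase
rightMask ⊢ = keep

φ : Tree → Word
φ leaf         = true ∷ []
φ (node g l r) = masked (leftMask g) (φ l) ++ masked (rightMask g) (φ r)

length-masked : ∀ m w → length (masked m w) ≡ length w
length-masked keep  w = refl
length-masked erase w = length-map (false ∧_) w

masked-∘ₙ : ∀ m x k y → masked m (x ∘ₙ[ k ] y) ≡ masked m x ∘ₙ[ k ] y
masked-∘ₙ keep  x k y = refl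
masked-∘ₙ erase x k y = kill-∘ₙ x k y

arity : ∀ t → length (φ t) ≡ leaves t
arity leaf         = refl
arity (node g l r) =
  trans (length-++ (masked (leftMask g) (φ l)))
    (cong₂ _+_ (trans (length-masked (leftMask g) (φ l)) (arity l))
               (trans (length-masked (rightMask g) (φ r)) (arity r)))

length-masked-φ : ∀ m t → length (masked m (φ t)) ≡ leaves t
length-masked-φ m t = trans (length-masked m (φ t)) (arity t)

φ-graft : ∀ s (i : Fin (leaves s)) t → φ (graft s i t) ≡ φ s ∘ₙ[ toℕ i ] φ t
φ-graft leaf zero t = sym (trans (++-identityʳ _) (map-id (φ t)))
φ-graft (node g l r) i t with splitAt (leaves l) i in eq
... | inj₁ j rewrite sym (splitAt⁻¹-↑ˡ eq) | toℕ-↑ˡ j (leaves r) = begin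
  masked (leftMask g) (φ (graft l j t)) ++ R              ≡⟨ cong (λ w → masked (leftMask g) w ++ R) (φ-graft l j t) ⟩
  masked (leftMask g) (φ l ∘ₙ[ toℕ j ] φ t) ++ R          ≡⟨ cong (_++ R) (masked-∘ₙ (leftMask g) (φ l) (toℕ j) (φ t)) ⟩
  (masked (leftMask g) (φ l) ∘ₙ[ toℕ j ] φ t) ++ R        ≡⟨ sym (∘ₙ-++ˡ (masked (leftMask g) (φ l)) R (φ t) (length-masked-φ (leftMask g) l) (toℕ<n j)) ⟩
  (masked (leftMask g) (φ l) ++ R) ∘ₙ[ toℕ j ] φ t        ∎
  where
  open ≡-Reasoning
  R : Word
  R = masked (rightMask g) (φ r)
... | inj₂ j rewrite sym (splitAt⁻¹-↑ʳ eq) | toℕ-↑ʳ (leaves l) j = begin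
  L ++ masked (rightMask g) (φ (graft r j t))             ≡⟨ cong (λ w → L ++ masked (rightMask g) w) (φ-graft r j t) ⟩
  L ++ masked (rightMask g) (φ r ∘ₙ[ toℕ j ] φ t)         ≡⟨ cong (L ++_) (masked-∘ₙ (rightMask g) (φ r) (toℕ j) (φ t)) ⟩
  L ++ (masked (rightMask g) (φ r) ∘ₙ[ toℕ j ] φ t)       ≡⟨ sym (∘ₙ-++ʳ L (masked (rightMask g) (φ r)) (toℕ j) (φ t) (length-masked-φ (leftMask g) l)) ⟩
  (L ++ masked (rightMask g) (φ r)) ∘ₙ[ leaves l + toℕ j ] φ t ∎
  where
  open ≡-Reasoning
  L : Word
  L = masked (leftMask g) (φ l)

-- φ-graft restated with the Fin position expected by DiasIsoD.
φ-comp : ∀ s (i : Fin (leaves s)) t → φ (graft s i t) ≡ (φ s ∘[ cast (sym (arity s)) i ] φ t)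
φ-comp s i t = trans (φ-graft s i t)
  (sym (trans (∘-as-∘ₙ (φ s) (cast (sym (arity s)) i) (φ t))
              (cong (λ k → φ s ∘ₙ[ k ] φ t) (toℕ-cast (sym (arity s)) i))))

ones-φ : ∀ t → ones (φ t) ≡ 1
ones-φ leaf         = refl
ones-φ (node ⊣ l r) = trans (ones-++ (φ l) (kill (φ r))) (cong₂ _+_ (ones-φ l) (ones-kill (φ r)))
ones-φ (node ⊢ l r) = trans (ones-++ (kill (φ l)) (φ r)) (cong₂ _+_ (ones-kill (φ l)) (ones-φ r))

-- Each diassociative relation becomes an equality of words.
respects : ∀ {s t} → s ≈D t → φ s ≡ φ t
respects r1 = refl
respects r2 = refl
respects r3 = refl
respects r4 = refl
respects r5 = refl
respects ≈refl = refl
respects (≈sym p) = sym (respects p)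
respects (≈trans p q) = trans (respects p) (respects q)
respects (≈comp {s} {s'} {t} {t'} p q i i' i≡i') = begin
  φ (graft s i t)            ≡⟨ φ-graft s i t ⟩
  φ s ∘ₙ[ toℕ i ] φ t        ≡⟨ cong (λ w → w ∘ₙ[ toℕ i ] φ t) (respects p) ⟩
  φ s' ∘ₙ[ toℕ i ] φ t       ≡⟨ cong₂ (λ k w → φ s' ∘ₙ[ k ] w) i≡i' (respects q) ⟩
  φ s' ∘ₙ[ toℕ i' ] φ t'     ≡⟨ sym (φ-graft s' i' t') ⟩
  φ (graft s' i' t')         ∎
  where open ≡-Reasoning

≈D-setoid : Setoid 0ℓ 0ℓ
≈D-setoid = record
  { Carrier = Tree
  ; _≈_ = _≈D_
  ; isEquivalence = record { refl = ≈refl ; sym = ≈sym ; trans = ≈trans }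
  }

module ≈D-Reasoning = Relation.Binary.Reasoning.Setoid ≈D-setoid

-- Substituting into a generator: node g l r is g with l and r grafted
-- onto its leaves (right leaf first, so both positions are literals).
node-cong : ∀ g {l l' r r'} → l ≈D l' → r ≈D r' → node g l r ≈D node g l' r'
node-cong g p q = ≈comp (≈comp (≈refl {gen g}) q (suc zero) (suc zero) refl) p zero zero refl

node-congˡ : ∀ g {l l'} r → l ≈D l' → node g l r ≈D node g l' r
node-congˡ g r p = node-cong g p ≈refl

node-congʳ : ∀ g l {r r'} → r ≈D r' → node g l r ≈D node g l r'
node-congʳ g l q = node-cong g ≈refl q

-- A relation between three-leaf trees holds for arbitrary subtrees
-- substituted into the leaves (again from the right, at literal positions).
instantiate₁₂ : ∀ {g h g' h'} → (g ∘₁ h) ≈D (g' ∘₂ h') →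
                ∀ x y z → node g (node h x y) z ≈D node g' x (node h' y z)
instantiate₁₂ e x y z =
  ≈comp (≈comp (≈comp e (≈refl {z}) (suc (suc zero)) (suc (suc zero)) refl)
                (≈refl {y}) (suc zero) (suc zero) refl)
        (≈refl {x}) zero zero refl

instantiate₂₂ : ∀ {g h g' h'} → (g ∘₂ h) ≈D (g' ∘₂ h') →
                ∀ x y z → node g x (node h y z) ≈D node g' x (node h' y z)
instantiate₂₂ e x y z =
  ≈comp (≈comp (≈comp e (≈refl {z}) (suc (suc zero)) (suc (suc zero)) refl)
                (≈refl {y}) (suc zero) (suc zero) refl)
        (≈refl {x}) zero zero refl

⊣-assoc : ∀ x y z → node ⊣ (node ⊣ x y) z ≈D node ⊣ x (node ⊣ y z)
⊣-assoc = instantiate₁₂ r1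

⊣-right : ∀ x y z → node ⊣ x (node ⊣ y z) ≈D node ⊣ x (node ⊢ y z)
⊣-right = instantiate₂₂ r2

⊢⊣-assoc : ∀ x y z → node ⊣ (node ⊢ x y) z ≈D node ⊢ x (node ⊣ y z)
⊢⊣-assoc = instantiate₁₂ r3

⊢-left : ∀ x y z → node ⊢ (node ⊣ x y) z ≈D node ⊢ x (node ⊢ y z)
⊢-left = instantiate₁₂ r4

⊢-assoc : ∀ x y z → node ⊢ (node ⊢ x y) z ≈D node ⊢ x (node ⊢ y z)
⊢-assoc = instantiate₁₂ (≈sym r5)

pad : ℕ → Tree → Tree
pad zero    t = t
pad (suc a) t = node ⊢ leaf (pad a t)

cap : ℕ → Tree
cap zero    = leaf
cap (suc b) = node ⊣ leaf (cap b)

-- The normal form with a leaves before and b leaves after the distinguished one.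
nf : ℕ → ℕ → Tree
nf a b = pad a (cap b)

pad-+ : ∀ m n t → pad m (pad n t) ≡ pad (m + n) t
pad-+ zero    n t = refl
pad-+ (suc m) n t = cong (node ⊢ leaf) (pad-+ m n t)

pad-cong : ∀ a {t t'} → t ≈D t' → pad a t ≈D pad a t'
pad-cong zero    p = p
pad-cong (suc a) p = node-congʳ ⊢ leaf (pad-cong a p)

pad-⊣ : ∀ a t r → node ⊣ (pad a t) r ≈D pad a (node ⊣ t r)
pad-⊣ zero    t r = ≈refl
pad-⊣ (suc a) t r = ≈trans (⊢⊣-assoc leaf (pad a t) r) (node-congʳ ⊢ leaf (pad-⊣ a t r))

-- On the right of ⊣ only the number of leaves matters.
cap-absorb : ∀ b r → node ⊣ (cap b) r ≈D cap (b + leaves r)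
cap-absorb zero leaf = ≈refl
cap-absorb zero (node g x y) = begin
  node ⊣ leaf (node g x y)       ≈⟨ to⊣ g ⟨
  node ⊣ leaf (node ⊣ x y)       ≈⟨ ⊣-assoc leaf x y ⟨
  node ⊣ (node ⊣ leaf x) y       ≈⟨ node-congˡ ⊣ y (cap-absorb zero x) ⟩
  node ⊣ (cap (leaves x)) y      ≈⟨ cap-absorb (leaves x) y ⟩
  cap (leaves x + leaves y)      ∎
  where
  open ≈D-Reasoning
  to⊣ : ∀ g → node ⊣ leaf (node ⊣ x y) ≈D node ⊣ leaf (node g x y)
  to⊣ ⊣ = ≈refl
  to⊣ ⊢ = ⊣-right leaf x y
cap-absorb (suc b) r = ≈trans (⊣-assoc leaf (cap b) r) (node-congʳ ⊣ leaf (cap-absorb b r))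

-- On the left of ⊢ only the number of leaves matters.
pad-absorb : ∀ l t → node ⊢ l t ≈D pad (leaves l) t
pad-absorb leaf t = ≈refl
pad-absorb (node g x y) t = begin
  node ⊢ (node g x y) t               ≈⟨ reassociate g ⟩
  node ⊢ x (node ⊢ y t)               ≈⟨ node-congʳ ⊢ x (pad-absorb y t) ⟩
  node ⊢ x (pad (leaves y) t)         ≈⟨ pad-absorb x (pad (leaves y) t) ⟩
  pad (leaves x) (pad (leaves y) t)   ≡⟨ pad-+ (leaves x) (leaves y) t ⟩
  pad (leaves x + leaves y) t         ∎
  where
  open ≈D-Reasoning
  reassociate : ∀ g → node ⊢ (node g x y) t ≈D node ⊢ x (node ⊢ y t)
  reassociate ⊣ = ⊢-left x y t
  reassociate ⊢ = ⊢-assoc x y t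

normalForm : ∀ t → ∃₂ λ a b → t ≈D nf a b
normalForm leaf = 0 , 0 , ≈refl
normalForm (node ⊣ l r) with normalForm l
... | a , b , l≈ = a , b + leaves r , (begin
  node ⊣ l r                  ≈⟨ node-congˡ ⊣ r l≈ ⟩
  node ⊣ (pad a (cap b)) r    ≈⟨ pad-⊣ a (cap b) r ⟩
  pad a (node ⊣ (cap b) r)    ≈⟨ pad-cong a (cap-absorb b r) ⟩
  nf a (b + leaves r)         ∎)
  where open ≈D-Reasoning
normalForm (node ⊢ l r) with normalForm r
... | a , b , r≈ = leaves l + a , b , (begin
  node ⊢ l r                  ≈⟨ node-congʳ ⊢ l r≈ ⟩
  node ⊢ l (nf a b)           ≈⟨ pad-absorb l (nf a b) ⟩
  pad (leaves l) (nf a b)     ≡⟨ pad-+ (leaves l) a (cap b) ⟩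
  nf (leaves l + a) b         ∎)
  where open ≈D-Reasoning

φ-nf : ∀ a b → φ (nf a b) ≡ oneAt a b
φ-nf (suc a) b = cong (false ∷_) (φ-nf a b)
φ-nf zero    b = φ-cap b
  where
  φ-cap : ∀ b → φ (cap b) ≡ true ∷ zeros b
  φ-cap zero    = refl
  φ-cap (suc b) = trans (cong (λ w → true ∷ kill w) (φ-cap b)) (cong (λ w → true ∷ false ∷ w) (kill-zeros b))

-- Trees with equal images have equal normal forms.
reflects : ∀ {s t} → φ s ≡ φ t → s ≈D t
reflects {s} {t} e with normalForm s | normalForm t
... | a , b , s≈ | c , d , t≈ with oneAt-injective images-equal
  where
  open ≡-Reasoning
  images-equal : oneAt a b ≡ oneAt c d
  images-equal = begin
    oneAt a b     ≡⟨ φ-nf a b ⟨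
    φ (nf a b)    ≡⟨ respects s≈ ⟨
    φ s           ≡⟨ e ⟩
    φ t           ≡⟨ respects t≈ ⟩
    φ (nf c d)    ≡⟨ φ-nf c d ⟩
    oneAt c d     ∎
... | refl , refl = ≈trans s≈ (≈sym t≈)

-- Every element of D is 0ᵃ 1 0ᵇ = φ (nf a b).
onto : ∀ {w} → InD w → Σ Tree (λ t → φ t ≡ w)
onto {w} p with ones≡1⇒oneAt w (InD⇒ones p)
... | a , b , refl = nf a b , φ-nf a b

diasIsoD : DiasIsoD
diasIsoD = record
  { φ        = φ
  ; arity    = arity
  ; into     = λ t → ones⇒InD (φ t) (ones-φ t)
  ; φ-unit   = refl
  ; φ-comp   = φ-comp
  ; respects = respects
  ; reflects = reflects
  ; onto     = onto
  }

mainTheorem10 : ((w : Word) → InD w ⇔ (ones w ≡ 1)) × DiasIsoD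
mainTheorem10 = (λ w → mk⇔ InD⇒ones (ones⇒InD w)) , diasIsoD
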